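{- For all integers $n\ge 4$ and $r\ge 3$, $\chi_D(K_r^{\times n})=r+1$, where $K_r^{\times n}$ is the $n$-fold weak product of the complete graph $K_r$ with itself.
   Context: The weak (direct) product $G\times H$ has vertex set $V(G)\times V(H)$, with $(g_1,h_1)$ adjacent to $(g_2,h_2)$ iff $g_1g_2\in E(G)$ and $h_1h_2\in E(H)$. The distinguishing chromatic number $\chi_D(G)$ is the least number of colors in a proper vertex coloring of $G$ such that the only automorphism of $G$ mapping every color class onto itself is the identity. -}

module Defs where

open import Data.Nat using (ℕ; _≤_)
open import Data.Fin using (Fin)
open import Data.Vec using (Vec; lookup)
open import Data.Product using (Σ; _×_; ∃)
open import Relation.Binary.PropositionalEquality using (_≡_)
open import Relation.Nullary using (¬_)
open import Function.Bundles using (_↔_; Inverse)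
open import Level using (0ℓ; suc)

record Graph : Set₁ where
  field
    V   : Set
    Adj : V → V → Set
open Graph public

K : ℕ → Graph
K r = record { V = Fin r ; Adj = λ a b → ¬ (a ≡ b) }

KrPow : ℕ → ℕ → Graph
KrPow r n = record
  { V   = Vec (Fin r) n
  ; Adj = λ u v → ∀ (i : Fin n) → Adj (K r) (lookup u i) (lookup v i) }

IsAutomorphism : (G : Graph) → (V G ↔ V G) → Set
IsAutomorphism G σ = ∀ u v → (Adj G u v → Adj G (f u) (f v)) × (Adj G (f u) (f v) → Adj G u v)
  where open Inverse σ renaming (to to f)

IsProperColoring : (G : Graph) (k : ℕ) → (V G → Fin k) → Set
IsProperColoring G k c = ∀ u v → Adj G u v → ¬ (c u ≡ c v)

IsDistinguishing : (G : Graph) (k : ℕ) → (V G → Fin k) → Set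
IsDistinguishing G k c =
  ∀ (σ : V G ↔ V G) → IsAutomorphism G σ →
    (∀ v → c (Inverse.to σ v) ≡ c v) → ∀ v → Inverse.to σ v ≡ v

HasDistProperColoring : Graph → ℕ → Set
HasDistProperColoring G k =
  Σ (V G → Fin k) λ c → IsProperColoring G k c × IsDistinguishing G k c

χD≡ : Graph → ℕ → Set
χD≡ G m = HasDistProperColoring G m × (∀ k → HasDistProperColoring G k → m ≤ k)

module Submission where

-- Lower bound: the r constant tuples form a clique, so at least r colours are needed, and by the
-- theorem of Greenwell and Lovász a proper r-colouring of K_r^{×n} (r ≥ 3) only depends on one
-- coordinate; transposing two values in another coordinate is then a non-trivial automorphism
-- fixing every colour class.
-- Upper bound: colour a tuple by its first entry, except on an independent set of "seeds",
-- "ladders" and "echoes", which get the extra colour r. Applying Greenwell–Lovász to each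
-- coordinate of an automorphism f shows f x k = φ_k (x (p k)) with p a permutation of the
-- coordinates and every φ_k injective; preserving the special set and the first entry off it
-- forces p and all φ_k to be identities.

open import Defs
open import Data.Nat as ℕ using (ℕ; zero; suc; _≤_; _+_; z≤n; s≤s)
import Data.Nat.Properties as ℕₚ
open import Data.Fin as Fin using (Fin; zero; suc; toℕ; punchIn; punchOut; fromℕ; inject₁)
import Data.Fin.Properties as Finₚ
open import Data.Fin.Permutation using (Permutation′; _⟨$⟩ʳ_; _⟨$⟩ˡ_; inverseˡ; inverseʳ; transpose)
open import Data.Vec using (Vec; []; _∷_; lookup; tabulate; replicate; _[_]≔_; _[_]%=_)
open import Data.Vec.Properties
  using (tabulate∘lookup; tabulate-cong; lookup∘tabulate; lookup-replicate; lookup∘update; lookup∘update′;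
         lookup∘updateAt; lookup∘updateAt′; updateAt-updateAt-local; updateAt-id-local)
open import Data.Product using (∃; ∃₂; _×_; _,_; proj₁; proj₂)
open import Data.Sum using (_⊎_; inj₁; inj₂; [_,_])
open import Function using (_∘_)
open import Function.Bundles using (_↔_; Inverse; mk↔ₛ′)
open import Function.Definitions using (Injective)
open import Relation.Nullary using (¬_; Dec; yes; no; contradiction; ¬?)
open import Relation.Nullary.Decidable using (_×-dec_; _⊎-dec_; _→-dec_)
open import Relation.Binary.Definitions using (DecidableEquality)
open import Relation.Binary.PropositionalEquality using (_≡_; _≢_; refl; sym; trans; cong; subst; subst₂)

lookup-ext : ∀ {a} {A : Set a} {n} (xs ys : Vec A n) → (∀ i → lookup xs i ≡ lookup ys i) → xs ≡ ys
lookup-ext xs ys eq = trans (sym (tabulate∘lookup xs)) (trans (tabulate-cong eq) (tabulate∘lookup ys))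

DiffersOnlyAt : ∀ {A : Set} {n} → Fin n → Vec A n → Vec A n → Set
DiffersOnlyAt j x y = ∀ l → l ≢ j → lookup x l ≡ lookup y l

differsOnlyAt-sym : ∀ {A : Set} {n j} (x y : Vec A n) → DiffersOnlyAt j x y → DiffersOnlyAt j y x
differsOnlyAt-sym x y d l l≢j = sym (d l l≢j)

differsOnlyAt⇒≡ : ∀ {A : Set} {n j} (x y : Vec A n) → DiffersOnlyAt j x y → lookup x j ≡ lookup y j → x ≡ y
differsOnlyAt⇒≡ {j = j} x y d xⱼ≡yⱼ = lookup-ext x y agree
  where
  agree : ∀ l → lookup x l ≡ lookup y l
  agree l with l Fin.≟ j
  ... | yes refl = xⱼ≡yⱼ
  ... | no l≢j   = d l l≢j

-- Walk from x to y changing one coordinate at a time.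
colour-change-at-single-coordinate : ∀ {A B : Set} {n} → DecidableEquality B →
  (c : Vec A n → B) (x y : Vec A n) → c x ≢ c y →
  ∃ λ l → ∃₂ λ u v → DiffersOnlyAt l u v × lookup u l ≡ lookup x l × lookup v l ≡ lookup y l × c u ≢ c v
colour-change-at-single-coordinate _≟_ c [] [] cx≢cy = contradiction refl cx≢cy
colour-change-at-single-coordinate _≟_ c (a ∷ xs) (b ∷ ys) cx≢cy with c (a ∷ xs) ≟ c (b ∷ xs)
... | no changed = zero , a ∷ xs , b ∷ xs , headOnly , refl , refl , changed
  where
  headOnly : DiffersOnlyAt zero (a ∷ xs) (b ∷ xs)
  headOnly zero    0≢0 = contradiction refl 0≢0
  headOnly (suc l) _   = refl
... | yes same with colour-change-at-single-coordinate _≟_ (c ∘ (b ∷_)) xs ys (cx≢cy ∘ trans same)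
...   | l , u , v , d , uₗ , vₗ , cu≢cv = suc l , b ∷ u , b ∷ v , tailOnly , uₗ , vₗ , cu≢cv
  where
  tailOnly : DiffersOnlyAt (suc l) (b ∷ u) (b ∷ v)
  tailOnly zero     _    = refl
  tailOnly (suc l′) l′≢l = d l′ (l′≢l ∘ cong suc)

injective⇒surjective : ∀ {n} (f : Fin n → Fin n) → Injective _≡_ _≡_ f → ∀ y → ∃ λ x → f x ≡ y
injective⇒surjective {suc n} f f-inj y with Finₚ.any? (λ x → f x Fin.≟ y)
... | yes hit = hit
... | no miss = contradiction (Finₚ.injective⇒≤ squeeze-inj) ℕₚ.1+n≰n
  where
  squeeze : Fin (suc n) → Fin n
  squeeze x = punchOut {i = y} {j = f x} (λ e → miss (x , sym e))
  squeeze-inj : Injective _≡_ _≡_ squeeze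
  squeeze-inj = f-inj ∘ Finₚ.punchOut-injective {i = y} _ _

injective-fixing-all-but-one : ∀ {n} (h : Fin n → Fin n) → Injective _≡_ _≡_ h →
  ∀ b → (∀ a → a ≢ b → h a ≡ a) → h b ≡ b
injective-fixing-all-but-one h h-inj b fix with h b Fin.≟ b
... | yes hb≡b = hb≡b
... | no hb≢b  = contradiction (h-inj (fix (h b) hb≢b)) hb≢b

monotone∧injective⇒id : ∀ {n} (h : Fin n → Fin n) → (∀ {q q′} → q Fin.≤ q′ → h q Fin.≤ h q′) →
  Injective _≡_ _≡_ h → ∀ q → h q ≡ q
monotone∧injective⇒id {suc n} h mono h-inj = fixed
  where
  -- zero is hit by some q, and h zero ≤ h q = zero by monotonicity
  h0≡0 : h zero ≡ zero
  h0≡0 with q , hq≡0 ← injective⇒surjective h h-inj zero =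
    Finₚ.toℕ-injective (ℕₚ.n≤0⇒n≡0 (subst (λ z → toℕ (h zero) ≤ toℕ z) hq≡0 (mono z≤n)))
  0≢hsuc : ∀ q → zero ≢ h (suc q)
  0≢hsuc q e = Finₚ.0≢1+n (h-inj (trans h0≡0 e))
  h′ : Fin n → Fin n
  h′ q = punchOut (0≢hsuc q)
  suc-h′ : ∀ q → suc (h′ q) ≡ h (suc q)
  suc-h′ q = Finₚ.punchIn-punchOut (0≢hsuc q)
  h′-mono : ∀ {q q′} → q Fin.≤ q′ → h′ q Fin.≤ h′ q′
  h′-mono {q} {q′} le = ℕ.s≤s⁻¹ (subst₂ (λ a b → toℕ a ≤ toℕ b) (sym (suc-h′ q)) (sym (suc-h′ q′)) (mono (s≤s le)))
  h′-inj : Injective _≡_ _≡_ h′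
  h′-inj {q} {q′} e = Finₚ.suc-injective (h-inj (trans (sym (suc-h′ q)) (trans (cong suc e) (suc-h′ q′))))
  fixed : ∀ q → h q ≡ q
  fixed zero    = h0≡0
  fixed (suc q) = trans (sym (suc-h′ q)) (cong suc (monotone∧injective⇒id h′ h′-mono h′-inj q))

avoid₂ : ∀ {m} (α β : Fin (2 + m)) → α ≢ β → Fin m → Fin (2 + m)
avoid₂ α β α≢β t = punchIn α (punchIn (punchOut α≢β) t)

avoid₂≢ˡ : ∀ {m} α β α≢β (t : Fin m) → avoid₂ α β α≢β t ≢ α
avoid₂≢ˡ α β α≢β t = Finₚ.punchInᵢ≢i α _

avoid₂≢ʳ : ∀ {m} α β α≢β (t : Fin m) → avoid₂ α β α≢β t ≢ β
avoid₂≢ʳ α β α≢β t e = Finₚ.punchInᵢ≢i (punchOut α≢β) t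
  (Finₚ.punchIn-injective α _ _ (trans e (sym (Finₚ.punchIn-punchOut α≢β))))

avoid₂-injective : ∀ {m} α β α≢β → Injective _≡_ _≡_ (avoid₂ {m} α β α≢β)
avoid₂-injective α β α≢β = Finₚ.punchIn-injective _ _ _ ∘ Finₚ.punchIn-injective α _ _

third : ∀ {m} → Fin (3 + m) → Fin (3 + m) → Fin (3 + m)
third zero          zero          = suc zero
third zero          (suc zero)    = suc (suc zero)
third zero          (suc (suc _)) = suc zero
third (suc _)       (suc _)       = zero
third (suc zero)    zero          = suc (suc zero)
third (suc (suc _)) zero          = suc zero

third≢ : ∀ {m} (a b : Fin (3 + m)) → third a b ≢ a × third a b ≢ b
third≢ zero          zero          = (λ ()) , (λ ())
third≢ zero          (suc zero)    = (λ ()) , (λ ())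
third≢ zero          (suc (suc _)) = (λ ()) , (λ ())
third≢ (suc _)       (suc _)       = (λ ()) , (λ ())
third≢ (suc zero)    zero          = (λ ()) , (λ ())
third≢ (suc (suc _)) zero          = (λ ()) , (λ ())

clique-sees-every-colour : (G : Graph) {k : ℕ} (c : V G → Fin k) → IsProperColoring G k c →
  (Q : Fin k → V G) → (∀ s t → s ≢ t → Adj G (Q s) (Q t)) → ∀ a → ∃ λ s → c (Q s) ≡ a
clique-sees-every-colour G c proper Q clique = injective⇒surjective (c ∘ Q) c∘Q-injective
  where
  c∘Q-injective : Injective _≡_ _≡_ (c ∘ Q)
  c∘Q-injective {s} {t} e with s Fin.≟ t
  ... | yes s≡t = s≡t
  ... | no s≢t  = contradiction e (proper _ _ (clique s t s≢t))

module ProperColouring {m n : ℕ} (c : Vec (Fin (3 + m)) n → Fin (3 + m))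
                       (proper : IsProperColoring (KrPow (3 + m) n) (3 + m) c) where

  Vertex : Set
  Vertex = Vec (Fin (3 + m)) n

  _~_ : Vertex → Vertex → Set
  _~_ = Adj (KrPow (3 + m) n)

  ~-sym : ∀ u v → u ~ v → v ~ u
  ~-sym u v u~v i e = u~v i (sym e)

  -- y, w and the r − 2 vertices avoiding both of them coordinatewise form an r-clique,
  -- and z is adjacent to all of the latter.
  mixture-colour : ∀ y w → y ~ w → ∀ z → (∀ i → lookup z i ≡ lookup y i ⊎ lookup z i ≡ lookup w i) →
    c z ≡ c y ⊎ c z ≡ c w
  mixture-colour y w y~w z mixed = colourOf (clique-sees-every-colour (KrPow (3 + m) n) c proper Q Q-clique (c z))
    where
    R : Fin (suc m) → Vertex
    R t = tabulate (λ i → avoid₂ (lookup y i) (lookup w i) (y~w i) t)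
    R-lookup : ∀ t i → lookup (R t) i ≡ avoid₂ (lookup y i) (lookup w i) (y~w i) t
    R-lookup t i = lookup∘tabulate _ i
    y~R : ∀ t → y ~ R t
    y~R t i e = avoid₂≢ˡ _ _ (y~w i) t (sym (trans e (R-lookup t i)))
    w~R : ∀ t → w ~ R t
    w~R t i e = avoid₂≢ʳ _ _ (y~w i) t (sym (trans e (R-lookup t i)))
    R~R : ∀ t t′ → t ≢ t′ → R t ~ R t′
    R~R t t′ t≢t′ i e = t≢t′ (avoid₂-injective _ _ (y~w i) (trans (sym (R-lookup t i)) (trans e (R-lookup t′ i))))
    z~R : ∀ t → z ~ R t
    z~R t i e = [ (λ zᵢ≡yᵢ → y~R t i (trans (sym zᵢ≡yᵢ) e)) , (λ zᵢ≡wᵢ → w~R t i (trans (sym zᵢ≡wᵢ) e)) ] (mixed i)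
    Q : Fin (3 + m) → Vertex
    Q zero          = y
    Q (suc zero)    = w
    Q (suc (suc t)) = R t
    Q-clique : ∀ s s′ → s ≢ s′ → Q s ~ Q s′
    Q-clique zero          zero           ne = contradiction refl ne
    Q-clique zero          (suc zero)     _  = y~w
    Q-clique zero          (suc (suc t))  _  = y~R t
    Q-clique (suc zero)    zero           _  = ~-sym y w y~w
    Q-clique (suc zero)    (suc zero)     ne = contradiction refl ne
    Q-clique (suc zero)    (suc (suc t))  _  = w~R t
    Q-clique (suc (suc t)) zero           _  = ~-sym y (R t) (y~R t)
    Q-clique (suc (suc t)) (suc zero)     _  = ~-sym w (R t) (w~R t)
    Q-clique (suc (suc t)) (suc (suc t′)) ne = R~R t t′ (λ e → ne (cong (λ q → suc (suc q)) e))
    colourOf : (∃ λ s → c (Q s) ≡ c z) → c z ≡ c y ⊎ c z ≡ c w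
    colourOf (zero , e)        = inj₁ (sym e)
    colourOf (suc zero , e)    = inj₂ (sym e)
    colourOf (suc (suc t) , e) = contradiction (sym e) (proper z (R t) (z~R t))

  record Critical (j : Fin n) (x y : Vertex) : Set where
    constructor critical
    field
      differsOnly   : DiffersOnlyAt j x y
      coloursDiffer : c x ≢ c y

  critical-sym : ∀ {j x y} → Critical j x y → Critical j y x
  critical-sym {x = x} {y} (critical d cx≢cy) = critical (differsOnlyAt-sym x y d) (cx≢cy ∘ sym)

  -- y ~ w and x is a mixture of y and w, so c x ∈ {c y, c w}.
  critical⇒antipode-colour : ∀ {j x y} → Critical j x y → ∀ w → lookup w j ≡ lookup x j →
    (∀ l → l ≢ j → lookup w l ≢ lookup x l) → c w ≡ c x
  critical⇒antipode-colour {j} {x} {y} (critical d cx≢cy) w wⱼ≡xⱼ w≢x =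
    [ (λ cx≡cy → contradiction cx≡cy cx≢cy) , sym ] (mixture-colour y w y~w x x-mixed)
    where
    y~w : y ~ w
    y~w i e with i Fin.≟ j
    ... | yes refl = cx≢cy (cong c (differsOnlyAt⇒≡ x y d (sym (trans e wⱼ≡xⱼ))))
    ... | no i≢j   = w≢x i i≢j (sym (trans (d i i≢j) e))
    x-mixed : ∀ i → lookup x i ≡ lookup y i ⊎ lookup x i ≡ lookup w i
    x-mixed i with i Fin.≟ j
    ... | yes refl = inj₂ (sym wⱼ≡xⱼ)
    ... | no i≢j   = inj₁ (d i i≢j)

  -- Pass through w with wⱼ = xⱼ and wₗ ∉ {xₗ, zₗ} elsewhere, and its partner w′ at yⱼ.
  critical⇒fibre-monochromatic : ∀ {j x y} → Critical j x y → ∀ z → lookup z j ≡ lookup x j → c z ≡ c x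
  critical⇒fibre-monochromatic {j} {x} {y} crit@(critical d cx≢cy) z zⱼ≡xⱼ = trans cz≡cw cw≡cx
    where
    w w′ : Vertex
    w  = tabulate (λ l → third (lookup x l) (lookup z l)) [ j ]≔ lookup x j
    w′ = w [ j ]≔ lookup y j
    w-off : ∀ l → l ≢ j → lookup w l ≡ third (lookup x l) (lookup z l)
    w-off l l≢j = trans (lookup∘update′ l≢j (tabulate _) (lookup x j)) (lookup∘tabulate _ l)
    w′-off : ∀ l → l ≢ j → lookup w′ l ≡ lookup w l
    w′-off l l≢j = lookup∘update′ l≢j w (lookup y j)
    cw≡cx : c w ≡ c x
    cw≡cx = critical⇒antipode-colour crit w (lookup∘update j (tabulate _) (lookup x j)) λ l l≢j →
      proj₁ (third≢ _ _) ∘ trans (sym (w-off l l≢j))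
    cw′≡cy : c w′ ≡ c y
    cw′≡cy = critical⇒antipode-colour (critical-sym crit) w′ (lookup∘update j w (lookup y j)) λ l l≢j e →
      proj₁ (third≢ _ _) (trans (sym (w-off l l≢j)) (trans (sym (w′-off l l≢j)) (trans e (sym (d l l≢j)))))
    cz≡cw : c z ≡ c w
    cz≡cw = critical⇒antipode-colour (critical (differsOnlyAt-sym w′ w w′-off) λ e → cx≢cy (trans (sym cw≡cx) (trans e cw′≡cy)))
      z (trans zⱼ≡xⱼ (sym (lookup∘update j (tabulate _) (lookup x j)))) λ l l≢j e →
      proj₂ (third≢ (lookup x l) (lookup z l)) (trans (sym (w-off l l≢j)) (sym e))

  critical-coordinate-unique : ∀ {j x y l u v} → Critical j x y → Critical l u v → j ≡ l
  critical-coordinate-unique {j} {x} {y} {l} {u} {v} critⱼ critₗ@(critical _ cu≢cv) with j Fin.≟ l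
  ... | yes j≡l = j≡l
  ... | no j≢l  = contradiction (trans (sym cz₁≡cu) (trans cz₁≡cx (trans (sym cz₂≡cx) cz₂≡cv))) cu≢cv
    where
    z₁ z₂ : Vertex
    z₁ = x [ l ]≔ lookup u l
    z₂ = x [ l ]≔ lookup v l
    cz₁≡cu : c z₁ ≡ c u
    cz₁≡cu = critical⇒fibre-monochromatic critₗ z₁ (lookup∘update l x _)
    cz₂≡cv : c z₂ ≡ c v
    cz₂≡cv = critical⇒fibre-monochromatic (critical-sym critₗ) z₂ (lookup∘update l x _)
    cz₁≡cx : c z₁ ≡ c x
    cz₁≡cx = critical⇒fibre-monochromatic critⱼ z₁ (lookup∘update′ j≢l x _)
    cz₂≡cx : c z₂ ≡ c x
    cz₂≡cx = critical⇒fibre-monochromatic critⱼ z₂ (lookup∘update′ j≢l x _)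

  greenwell-lovász : ∃ λ j → ∀ x y → lookup x j ≡ lookup y j → c x ≡ c y
  greenwell-lovász = fromCritical (colour-change-at-single-coordinate Fin._≟_ c zeros ones (proper zeros ones zeros~ones))
    where
    zeros ones : Vertex
    zeros = replicate n zero
    ones  = replicate n (suc zero)
    zeros~ones : zeros ~ ones
    zeros~ones i e = Finₚ.0≢1+n (trans (sym (lookup-replicate i zero)) (trans e (lookup-replicate i (suc zero))))
    fromCritical : (∃ λ j → ∃₂ λ u v → DiffersOnlyAt j u v × lookup u j ≡ lookup zeros j × lookup v j ≡ lookup ones j × c u ≢ c v) →
      ∃ λ j → ∀ x y → lookup x j ≡ lookup y j → c x ≡ c y
    fromCritical (j , u , v , d , _ , _ , cu≢cv) = j , determined
      where
      determined : ∀ x y → lookup x j ≡ lookup y j → c x ≡ c y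
      determined x y xⱼ≡yⱼ with c x Fin.≟ c y
      ... | yes cx≡cy = cx≡cy
      ... | no cx≢cy with colour-change-at-single-coordinate Fin._≟_ c x y cx≢cy
      ...   | l , u′ , v′ , d′ , u′ₗ≡xₗ , v′ₗ≡yₗ , cu′≢cv′ with critical-coordinate-unique (critical d cu≢cv) (critical d′ cu′≢cv′)
      ...     | refl = contradiction (cong c (differsOnlyAt⇒≡ u′ v′ d′ (trans u′ₗ≡xₗ (trans xⱼ≡yⱼ (sym v′ₗ≡yₗ))))) cu′≢cv′

coordinatePermutation : ∀ {r n} → Fin n → Permutation′ r → Vec (Fin r) n ↔ Vec (Fin r) n
coordinatePermutation j π = mk↔ₛ′ (_[ j ]%= (π ⟨$⟩ʳ_)) (_[ j ]%= (π ⟨$⟩ˡ_)) (cancel (inverseʳ π)) (cancel (inverseˡ π))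
  where
  cancel : ∀ {f g : Fin _ → Fin _} → (∀ {a} → f (g a) ≡ a) → ∀ x → (x [ j ]%= g) [ j ]%= f ≡ x
  cancel fg≡id x = trans (updateAt-updateAt-local j {h = λ a → a} x fg≡id) (updateAt-id-local j x refl)

coordinatePermutation-isAutomorphism : ∀ {r n} (j : Fin n) (π : Permutation′ r) →
  IsAutomorphism (KrPow r n) (coordinatePermutation j π)
coordinatePermutation-isAutomorphism j π u v = (λ u~v i → u~v i ∘ reflects i) , (λ σu~σv i → σu~σv i ∘ preserves i)
  where
  σ : Vec (Fin _) _ → Vec (Fin _) _
  σ = _[ j ]%= (π ⟨$⟩ʳ_)
  preserves : ∀ i → lookup u i ≡ lookup v i → lookup (σ u) i ≡ lookup (σ v) i
  preserves i e with i Fin.≟ j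
  ... | yes refl = trans (lookup∘updateAt i u) (trans (cong (π ⟨$⟩ʳ_) e) (sym (lookup∘updateAt i v)))
  ... | no i≢j   = trans (lookup∘updateAt′ i j i≢j u) (trans e (sym (lookup∘updateAt′ i j i≢j v)))
  reflects : ∀ i → lookup (σ u) i ≡ lookup (σ v) i → lookup u i ≡ lookup v i
  reflects i e with i Fin.≟ j
  ... | yes refl = trans (sym (inverseˡ π)) (trans (cong (π ⟨$⟩ˡ_)
                     (trans (sym (lookup∘updateAt i u)) (trans e (lookup∘updateAt i v)))) (inverseˡ π))
  ... | no i≢j   = trans (sym (lookup∘updateAt′ i j i≢j u)) (trans e (lookup∘updateAt′ i j i≢j v))

-- The constant vectors form an r-clique.
proper-colouring-bound : ∀ {r n k} (c : Vec (Fin r) n → Fin k) → IsProperColoring (KrPow r n) k c → r ≤ k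
proper-colouring-bound {r} {n} c proper = Finₚ.injective⇒≤ diagonal-injective
  where
  diagonal-injective : Injective _≡_ _≡_ (c ∘ replicate n)
  diagonal-injective {a} {b} e with a Fin.≟ b
  ... | yes a≡b = a≡b
  ... | no a≢b  = contradiction e (proper _ _ λ i e′ →
                    a≢b (trans (sym (lookup-replicate i a)) (trans e′ (lookup-replicate i b))))

-- The colour depends on one coordinate only, so swapping two values in another one is invisible.
proper-r-colouring-not-distinguishing : ∀ {m n} (c : Vec (Fin (3 + m)) (2 + n) → Fin (3 + m)) →
  IsProperColoring (KrPow (3 + m) (2 + n)) (3 + m) c → ¬ IsDistinguishing (KrPow (3 + m) (2 + n)) (3 + m) c
proper-r-colouring-not-distinguishing {m} {n} c proper distinguishing
  with j , determined ← ProperColouring.greenwell-lovász c proper =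
  Finₚ.0≢1+n (trans (sym (lookup-replicate j′ zero)) (trans (cong (λ x → lookup x j′) (sym (fixes zeros))) moved))
  where
  j′ : Fin (2 + n)
  j′ = punchIn j zero
  σ : Vec (Fin (3 + m)) (2 + n) ↔ Vec (Fin (3 + m)) (2 + n)
  σ = coordinatePermutation j′ (transpose zero (suc zero))
  fixes : ∀ x → Inverse.to σ x ≡ x
  fixes = distinguishing σ (coordinatePermutation-isAutomorphism j′ (transpose zero (suc zero)))
    λ x → determined _ x (lookup∘updateAt′ j j′ (Finₚ.punchInᵢ≢i j zero ∘ sym) x)
  zeros : Vec (Fin (3 + m)) (2 + n)
  zeros = replicate (2 + n) zero
  moved : lookup (Inverse.to σ zeros) j′ ≡ suc zero
  moved = trans (lookup∘updateAt j′ zeros) (cong (transpose zero (suc zero) ⟨$⟩ʳ_) (lookup-replicate j′ zero))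

distinguishing-colouring-bound : ∀ {m n k} (c : Vec (Fin (3 + m)) (2 + n) → Fin k) →
  IsProperColoring (KrPow (3 + m) (2 + n)) k c → IsDistinguishing (KrPow (3 + m) (2 + n)) k c → 4 + m ≤ k
distinguishing-colouring-bound c proper distinguishing with ℕₚ.m≤n⇒m<n∨m≡n (proper-colouring-bound c proper)
... | inj₁ r<k  = r<k
... | inj₂ refl = contradiction distinguishing (proper-r-colouring-not-distinguishing c proper)

module AutomorphismStructure {m n : ℕ} (σ : Vec (Fin (3 + m)) n ↔ Vec (Fin (3 + m)) n)
                             (automorphism : IsAutomorphism (KrPow (3 + m) n) σ) where

  open Inverse σ using () renaming (to to f; from to f⁻¹)

  private
    coordinateColouring : Fin n → Vec (Fin (3 + m)) n → Fin (3 + m)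
    coordinateColouring k x = lookup (f x) k

    determinedBy : ∀ k → ∃ λ j → ∀ x y → lookup x j ≡ lookup y j → lookup (f x) k ≡ lookup (f y) k
    determinedBy k = ProperColouring.greenwell-lovász (coordinateColouring k) λ u v u~v → proj₁ (automorphism u v) u~v k

  source : Fin n → Fin n
  source k = proj₁ (determinedBy k)

  φ : Fin n → Fin (3 + m) → Fin (3 + m)
  φ k a = lookup (f (replicate n a)) k

  lookup-to : ∀ x k → lookup (f x) k ≡ φ k (lookup x (source k))
  lookup-to x k = proj₂ (determinedBy k) x (replicate n (lookup x (source k))) (sym (lookup-replicate (source k) _))

  φ-injective : ∀ k → Injective _≡_ _≡_ (φ k)
  φ-injective k {a} {b} e with a Fin.≟ b
  ... | yes a≡b = a≡b
  ... | no a≢b  = contradiction e (proj₁ (automorphism (replicate n a) (replicate n b)) diagonal-adjacent k)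
    where
    diagonal-adjacent : Adj (KrPow (3 + m) n) (replicate n a) (replicate n b)
    diagonal-adjacent i e′ = a≢b (trans (sym (lookup-replicate i a)) (trans e′ (lookup-replicate i b)))

  -- Otherwise no preimage could take the values 0 and 1 at the common source.
  source-injective : Injective _≡_ _≡_ source
  source-injective {k} {k′} e with k Fin.≟ k′
  ... | yes k≡k′ = k≡k′
  ... | no k≢k′  = contradiction (trans (sym (preimage-at k zero y-at-k)) (trans (cong (lookup x) e) (preimage-at k′ (suc zero) y-at-k′))) Finₚ.0≢1+n
    where
    y x : Vec (Fin (3 + m)) n
    y = replicate n (φ k′ (suc zero)) [ k ]≔ φ k zero
    x = f⁻¹ y
    preimage-at : ∀ l a → lookup y l ≡ φ l a → lookup x (source l) ≡ a
    preimage-at l a yₗ≡φa = φ-injective l (trans (sym (lookup-to x l)) (trans (cong (λ z → lookup z l) (Inverse.inverseˡ σ refl)) yₗ≡φa))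
    y-at-k : lookup y k ≡ φ k zero
    y-at-k = lookup∘update k (replicate n _) _
    y-at-k′ : lookup y k′ ≡ φ k′ (suc zero)
    y-at-k′ = trans (lookup∘update′ (k≢k′ ∘ sym) (replicate n _) _) (lookup-replicate k′ _)

module UpperBound (n m : ℕ) where

  Vertex : Set
  Vertex = Vec (Fin (3 + m)) (4 + n)

  Position : Set
  Position = Fin (2 + n)

  pos : Position → Fin (4 + n)
  pos q = suc (suc q)

  _!_ : Vertex → Fin (4 + n) → Fin (3 + m)
  _!_ = lookup

  Seed Ladder Echo Special : Vertex → Set
  Seed   x = x ! zero ≢ zero × x ! suc zero ≡ x ! zero × (∀ q → x ! pos q ≡ zero)
  Ladder x = x ! zero ≡ zero × x ! pos zero ≡ zero × (∀ q → x ! pos q ≡ zero ⊎ x ! pos q ≡ x ! suc zero)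
           × (∀ q q′ → q Fin.≤ q′ → x ! pos q′ ≡ zero → x ! pos q ≡ zero)
  Echo   x = x ! zero ≡ zero × (∃ λ t → x ! suc zero ≡ suc (suc t)) × x ! pos zero ≡ x ! suc zero
           × (∀ q → x ! pos (suc q) ≡ zero)
  Special x = Seed x ⊎ Ladder x ⊎ Echo x

  atLeastTwo? : (a : Fin (3 + m)) → Dec (∃ λ t → a ≡ suc (suc t))
  atLeastTwo? zero          = no λ ()
  atLeastTwo? (suc zero)    = no λ ()
  atLeastTwo? (suc (suc t)) = yes (t , refl)

  special? : ∀ x → Dec (Special x)
  special? x = seed? ⊎-dec ladder? ⊎-dec echo?
    where
    seed?   = ¬? (x ! zero Fin.≟ zero) ×-dec (x ! suc zero Fin.≟ x ! zero) ×-dec Finₚ.all? (λ q → x ! pos q Fin.≟ zero)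
    ladder? = (x ! zero Fin.≟ zero) ×-dec (x ! pos zero Fin.≟ zero)
      ×-dec Finₚ.all? (λ q → (x ! pos q Fin.≟ zero) ⊎-dec (x ! pos q Fin.≟ x ! suc zero))
      ×-dec Finₚ.all? (λ q → Finₚ.all? λ q′ → (q Finₚ.≤? q′) →-dec (x ! pos q′ Fin.≟ zero) →-dec (x ! pos q Fin.≟ zero))
    echo?   = (x ! zero Fin.≟ zero) ×-dec atLeastTwo? (x ! suc zero) ×-dec (x ! pos zero Fin.≟ x ! suc zero)
      ×-dec Finₚ.all? (λ q → x ! pos (suc q) Fin.≟ zero)

  colouring : Vertex → Fin (4 + m)
  colouring x with special? x
  ... | yes _ = fromℕ (3 + m)
  ... | no _  = inject₁ (x ! zero)

  -- A seed shares the entry zero with every special vertex at pos 0 or pos 1; ladders and echoes share it at 0.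
  special-independent : ∀ u v → Special u → Special v → ¬ Adj (KrPow (3 + m) (4 + n)) u v
  special-independent u v (inj₁ (_ , _ , u0)) (inj₁ (_ , _ , v0))                 u~v = u~v (pos zero) (trans (u0 zero) (sym (v0 zero)))
  special-independent u v (inj₁ (_ , _ , u0)) (inj₂ (inj₁ (_ , v0 , _)))          u~v = u~v (pos zero) (trans (u0 zero) (sym v0))
  special-independent u v (inj₁ (_ , _ , u0)) (inj₂ (inj₂ (_ , _ , _ , v0)))      u~v = u~v (pos (suc zero)) (trans (u0 (suc zero)) (sym (v0 zero)))
  special-independent u v (inj₂ (inj₁ (_ , u0 , _))) (inj₁ (_ , _ , v0))          u~v = u~v (pos zero) (trans u0 (sym (v0 zero)))
  special-independent u v (inj₂ (inj₂ (_ , _ , _ , u0))) (inj₁ (_ , _ , v0))      u~v = u~v (pos (suc zero)) (trans (u0 zero) (sym (v0 (suc zero))))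
  special-independent u v (inj₂ (inj₁ (u0 , _))) (inj₂ (inj₁ (v0 , _)))          u~v = u~v zero (trans u0 (sym v0))
  special-independent u v (inj₂ (inj₁ (u0 , _))) (inj₂ (inj₂ (v0 , _)))          u~v = u~v zero (trans u0 (sym v0))
  special-independent u v (inj₂ (inj₂ (u0 , _))) (inj₂ (inj₁ (v0 , _)))          u~v = u~v zero (trans u0 (sym v0))
  special-independent u v (inj₂ (inj₂ (u0 , _))) (inj₂ (inj₂ (v0 , _)))          u~v = u~v zero (trans u0 (sym v0))

  colouring-proper : IsProperColoring (KrPow (3 + m) (4 + n)) (4 + m) colouring
  colouring-proper u v u~v e with special? u | special? v
  ... | yes su | yes sv = special-independent u v su sv u~v
  ... | yes _  | no _   = Finₚ.fromℕ≢inject₁ e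
  ... | no _   | yes _  = Finₚ.fromℕ≢inject₁ (sym e)
  ... | no _   | no _   = u~v zero (Finₚ.inject₁-injective e)

  colouring-≡ : ∀ x y → colouring x ≡ colouring y → (Special x × Special y) ⊎ (¬ Special x × ¬ Special y × x ! zero ≡ y ! zero)
  colouring-≡ x y e with special? x | special? y
  ... | yes sx | yes sy = inj₁ (sx , sy)
  ... | yes _  | no _   = contradiction e Finₚ.fromℕ≢inject₁
  ... | no _   | yes _  = contradiction (sym e) Finₚ.fromℕ≢inject₁
  ... | no nx  | no ny  = inj₂ (nx , ny , Finₚ.inject₁-injective e)

  unitAt₀ seed gapped echo : Fin (3 + m) → Vertex
  unitAt₀ a = a ∷ zero ∷ replicate _ zero
  seed    a = a ∷ a ∷ replicate _ zero
  gapped  a = zero ∷ a ∷ zero ∷ replicate _ a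
  echo    a = zero ∷ a ∷ a ∷ replicate _ zero

  ones : Vertex
  ones = zero ∷ suc zero ∷ replicate _ (suc zero)

  step : Position → Position → Fin (3 + m)
  step j q with q Finₚ.≤? j
  ... | yes _ = zero
  ... | no _  = suc zero

  staircase : Position → Vertex
  staircase j = zero ∷ suc zero ∷ tabulate (step j)

  step-≤ : ∀ j q → q Fin.≤ j → step j q ≡ zero
  step-≤ j q q≤j with q Finₚ.≤? j
  ... | yes _   = refl
  ... | no q≰j  = contradiction q≤j q≰j

  step-≰ : ∀ j q → ¬ q Fin.≤ j → step j q ≡ suc zero
  step-≰ j q q≰j with q Finₚ.≤? j
  ... | yes q≤j = contradiction q≤j q≰j
  ... | no _    = refl

  step≡0⇒≤ : ∀ j q → step j q ≡ zero → q Fin.≤ j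
  step≡0⇒≤ j q e with q Finₚ.≤? j
  ... | yes q≤j = q≤j
  ... | no _    = contradiction e λ ()

  unitAt₀-off : ∀ a k → k ≢ zero → unitAt₀ a ! k ≡ zero
  unitAt₀-off a zero          k≢0 = contradiction refl k≢0
  unitAt₀-off a (suc zero)    _   = refl
  unitAt₀-off a (suc (suc q)) _   = lookup-replicate q zero

  unitAt₀-not-special : ∀ a → a ≢ zero → ¬ Special (unitAt₀ a)
  unitAt₀-not-special a a≢0 (inj₁ (_ , 0≡a , _))       = a≢0 (sym 0≡a)
  unitAt₀-not-special a a≢0 (inj₂ (inj₁ (a≡0 , _)))    = a≢0 a≡0
  unitAt₀-not-special a a≢0 (inj₂ (inj₂ (a≡0 , _)))    = a≢0 a≡0

  ones-not-special : ¬ Special ones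
  ones-not-special (inj₁ (0≢0 , _))                = 0≢0 refl
  ones-not-special (inj₂ (inj₁ (_ , () , _)))
  ones-not-special (inj₂ (inj₂ (_ , (_ , ()) , _)))

  seed-special : ∀ a → a ≢ zero → Special (seed a)
  seed-special a a≢0 = inj₁ (a≢0 , refl , λ q → lookup-replicate q zero)

  staircase-special : ∀ j → Special (staircase j)
  staircase-special j = inj₂ (inj₁ (refl , trans (lookup∘tabulate (step j) zero) (step-≤ j zero z≤n) , values , downClosed))
    where
    values : ∀ q → staircase j ! pos q ≡ zero ⊎ staircase j ! pos q ≡ suc zero
    values q with q Finₚ.≤? j
    ... | yes q≤j = inj₁ (trans (lookup∘tabulate (step j) q) (step-≤ j q q≤j))
    ... | no q≰j  = inj₂ (trans (lookup∘tabulate (step j) q) (step-≰ j q q≰j))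
    downClosed : ∀ q q′ → q Fin.≤ q′ → staircase j ! pos q′ ≡ zero → staircase j ! pos q ≡ zero
    downClosed q q′ q≤q′ e = trans (lookup∘tabulate (step j) q)
      (step-≤ j q (ℕₚ.≤-trans q≤q′ (step≡0⇒≤ j q′ (trans (sym (lookup∘tabulate (step j) q′)) e))))

  gapped-special : ∀ a → Special (gapped a)
  gapped-special a = inj₂ (inj₁ (refl , refl , values , downClosed))
    where
    values : ∀ q → gapped a ! pos q ≡ zero ⊎ gapped a ! pos q ≡ a
    values zero    = inj₁ refl
    values (suc q) = inj₂ (lookup-replicate q a)
    downClosed : ∀ q q′ → q Fin.≤ q′ → gapped a ! pos q′ ≡ zero → gapped a ! pos q ≡ zero
    downClosed zero    _        _  _ = refl
    downClosed (suc q) (suc q′) _  e = trans (lookup-replicate q a) (trans (sym (lookup-replicate q′ a)) e)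

  echo-special : ∀ t → Special (echo (suc (suc t)))
  echo-special t = inj₂ (inj₂ (refl , (t , refl) , refl , λ q → lookup-replicate q zero))

  ladder-when-second≡1 : ∀ x → Special x → x ! zero ≡ zero → x ! suc zero ≡ suc zero → Ladder x
  ladder-when-second≡1 x (inj₁ (x₀≢0 , _))               x₀≡0 _    = contradiction x₀≡0 x₀≢0
  ladder-when-second≡1 x (inj₂ (inj₁ l))                 _    _    = l
  ladder-when-second≡1 x (inj₂ (inj₂ (_ , (_ , e) , _))) _    x₁≡1 = contradiction (trans (sym x₁≡1) e) λ ()

  ladder-when-unechoed : ∀ x → Special x → x ! zero ≡ zero → x ! pos zero ≢ x ! suc zero → Ladder x
  ladder-when-unechoed x (inj₁ (x₀≢0 , _))           x₀≡0 _  = contradiction x₀≡0 x₀≢0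
  ladder-when-unechoed x (inj₂ (inj₁ l))             _    _  = l
  ladder-when-unechoed x (inj₂ (inj₂ (_ , _ , e , _))) _  ne = contradiction e ne

  echo-when-pos₀≢0 : ∀ x → Special x → x ! zero ≡ zero → x ! pos zero ≢ zero → Echo x
  echo-when-pos₀≢0 x (inj₁ (x₀≢0 , _))         x₀≡0 _  = contradiction x₀≡0 x₀≢0
  echo-when-pos₀≢0 x (inj₂ (inj₁ (_ , e , _))) _    ne = contradiction e ne
  echo-when-pos₀≢0 x (inj₂ (inj₂ e))           _    _  = e

  module ColourPreserving (σ : Vertex ↔ Vertex) (automorphism : IsAutomorphism (KrPow (3 + m) (4 + n)) σ)
                          (preserves : ∀ x → colouring (Inverse.to σ x) ≡ colouring x) where

    open Inverse σ using () renaming (to to f)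
    open AutomorphismStructure σ automorphism

    special-preserved : ∀ x → Special x → Special (f x)
    special-preserved x sx with colouring-≡ (f x) x (preserves x)
    ... | inj₁ (sfx , _)     = sfx
    ... | inj₂ (_ , ¬sx , _) = contradiction sx ¬sx

    first-preserved : ∀ x → ¬ Special x → f x ! zero ≡ x ! zero
    first-preserved x ¬sx with colouring-≡ (f x) x (preserves x)
    ... | inj₁ (_ , sx)     = contradiction sx ¬sx
    ... | inj₂ (_ , _ , e)  = e

    φ-at : ∀ x k {a} → x ! source k ≡ a → φ k a ≡ f x ! k
    φ-at x k refl = sym (lookup-to x k)

    source-first : source zero ≡ zero
    source-first with source zero Fin.≟ zero
    ... | yes e  = e
    ... | no ne  = contradiction (trans (sym (value (suc zero) λ ())) (value (suc (suc zero)) λ ())) λ ()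
      where
      value : ∀ a → a ≢ zero → φ zero zero ≡ a
      value a a≢0 = trans (φ-at (unitAt₀ a) zero (unitAt₀-off a _ ne)) (first-preserved _ (unitAt₀-not-special a a≢0))

    first-fixed : ∀ x → f x ! zero ≡ x ! zero
    first-fixed x = trans (sym (φ-at x zero (cong (x !_) source-first))) (φ-first (x ! zero))
      where
      φ-first : ∀ a → φ zero a ≡ a
      φ-first zero    = trans (φ-at ones zero (cong (ones !_) source-first)) (first-preserved ones ones-not-special)
      φ-first (suc a) = trans (φ-at (unitAt₀ (suc a)) zero (cong (unitAt₀ (suc a) !_) source-first))
                              (first-preserved _ (unitAt₀-not-special (suc a) λ ()))

    seed-fixed : ∀ a → a ≢ zero → f (seed a) ≡ seed a
    seed-fixed a a≢0 = lookup-ext _ _ agree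
      where
      image-is-seed : Seed (f (seed a))
      image-is-seed with special-preserved (seed a) (seed-special a a≢0)
      ... | inj₁ s                = s
      ... | inj₂ (inj₁ (e , _))   = contradiction (trans (sym (first-fixed (seed a))) e) a≢0
      ... | inj₂ (inj₂ (e , _))   = contradiction (trans (sym (first-fixed (seed a))) e) a≢0
      agree : ∀ i → f (seed a) ! i ≡ seed a ! i
      agree zero          = first-fixed (seed a)
      agree (suc zero)    = trans (proj₁ (proj₂ image-is-seed)) (first-fixed (seed a))
      agree (suc (suc q)) = trans (proj₂ (proj₂ image-is-seed) q) (sym (lookup-replicate q zero))

    source-second : source (suc zero) ≡ suc zero
    source-second with source (suc zero) in eq
    ... | zero          = contradiction (source-injective (trans eq (sym source-first))) λ ()
    ... | suc zero      = refl
    ... | suc (suc q)   = contradiction (trans (sym (value (suc zero) λ ())) (value (suc (suc zero)) λ ())) λ ()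
      where
      value : ∀ a → a ≢ zero → φ (suc zero) zero ≡ a
      value a a≢0 = trans (φ-at (seed a) (suc zero) (trans (cong (seed a !_) eq) (lookup-replicate q zero)))
                          (cong (_! suc zero) (seed-fixed a a≢0))

    second-fixed : ∀ x → f x ! suc zero ≡ x ! suc zero
    second-fixed x = trans (sym (φ-at x (suc zero) (cong (x !_) source-second))) (φ-second (x ! suc zero))
      where
      φ-second-nonzero : ∀ a → a ≢ zero → φ (suc zero) a ≡ a
      φ-second-nonzero a a≢0 = trans (φ-at (seed a) (suc zero) (cong (seed a !_) source-second))
                                     (cong (_! suc zero) (seed-fixed a a≢0))
      φ-second : ∀ a → φ (suc zero) a ≡ a
      φ-second zero    = injective-fixing-all-but-one _ (φ-injective (suc zero)) zero φ-second-nonzero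
      φ-second (suc a) = φ-second-nonzero (suc a) λ ()

    source-pos : ∀ q → ∃ λ q′ → source (pos q) ≡ pos q′
    source-pos q with source (pos q) in eq
    ... | zero        = contradiction (source-injective (trans eq (sym source-first))) λ ()
    ... | suc zero    = contradiction (source-injective (trans eq (sym source-second))) λ ()
    ... | suc (suc q′) = q′ , refl

    π : Position → Position
    π q = proj₁ (source-pos q)

    lookup-to-π : ∀ x q → f x ! pos q ≡ φ (pos q) (x ! pos (π q))
    lookup-to-π x q = sym (φ-at x (pos q) (cong (x !_) (proj₂ (source-pos q))))

    φ-pos-zero : ∀ q → φ (pos q) zero ≡ zero
    φ-pos-zero q = trans (cong (φ (pos q)) (sym (lookup-replicate (π q) zero)))
      (trans (sym (lookup-to-π (seed (suc zero)) q)) (trans (cong (_! pos q) (seed-fixed (suc zero) λ ())) (lookup-replicate q zero)))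

    φ-pos≡0 : ∀ q {a} → φ (pos q) a ≡ zero → a ≡ zero
    φ-pos≡0 q e = φ-injective (pos q) (trans e (sym (φ-pos-zero q)))

    -- The image of a staircase is a ladder, whose zeros are down-closed.
    π-monotone : ∀ {q q′} → q Fin.≤ q′ → π q Fin.≤ π q′
    π-monotone {q} {q′} q≤q′ = step≡0⇒≤ (π q′) (π q) (trans (sym (lookup∘tabulate (step (π q′)) (π q))) stair-zero)
      where
      stairs : Vertex
      stairs = staircase (π q′)
      x : Vertex
      x = f stairs
      ladder : Ladder x
      ladder = ladder-when-second≡1 x (special-preserved stairs (staircase-special (π q′))) (first-fixed stairs) (second-fixed stairs)
      xq′ : x ! pos q′ ≡ zero
      xq′ = trans (lookup-to-π stairs q′) (trans (cong (φ (pos q′))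
              (trans (lookup∘tabulate (step (π q′)) (π q′)) (step-≤ (π q′) (π q′) ℕₚ.≤-refl))) (φ-pos-zero q′))
      stair-zero : stairs ! pos (π q) ≡ zero
      stair-zero = φ-pos≡0 q (trans (sym (lookup-to-π stairs q)) (proj₂ (proj₂ (proj₂ ladder)) q q′ q≤q′ xq′))

    π-injective : Injective _≡_ _≡_ π
    π-injective {q} {q′} e = Finₚ.suc-injective (Finₚ.suc-injective
      (source-injective (trans (proj₂ (source-pos q)) (trans (cong pos e) (sym (proj₂ (source-pos q′)))))))

    lookup-to-pos : ∀ x q → f x ! pos q ≡ φ (pos q) (x ! pos q)
    lookup-to-pos x q = trans (lookup-to-π x q)
      (cong (λ q′ → φ (pos q) (x ! pos q′)) (monotone∧injective⇒id π π-monotone π-injective q))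

    φ-pos-gapped : ∀ a → a ≢ zero → ∀ q → φ (pos (suc q)) a ≡ a
    φ-pos-gapped a a≢0 q = fromLadderValue (proj₁ (proj₂ (proj₂ ladder)) (suc q))
      where
      x : Vertex
      x = f (gapped a)
      x-pos₀ : x ! pos zero ≡ zero
      x-pos₀ = trans (lookup-to-pos (gapped a) zero) (φ-pos-zero zero)
      ladder : Ladder x
      ladder = ladder-when-unechoed x (special-preserved _ (gapped-special a)) (first-fixed (gapped a))
        λ e → a≢0 (trans (sym (second-fixed (gapped a))) (trans (sym e) x-pos₀))
      x-pos : x ! pos (suc q) ≡ φ (pos (suc q)) a
      x-pos = trans (lookup-to-pos (gapped a) (suc q)) (cong (φ (pos (suc q))) (lookup-replicate q a))
      fromLadderValue : x ! pos (suc q) ≡ zero ⊎ x ! pos (suc q) ≡ x ! suc zero → φ (pos (suc q)) a ≡ a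
      fromLadderValue (inj₁ e) = contradiction (φ-pos≡0 (suc q) (trans (sym x-pos) e)) a≢0
      fromLadderValue (inj₂ e) = trans (sym x-pos) (trans e (second-fixed (gapped a)))

    φ-pos-echo : ∀ t → φ (pos zero) (suc (suc t)) ≡ suc (suc t)
    φ-pos-echo t = trans (sym x-pos₀) (trans (proj₁ (proj₂ (proj₂ echoes))) (second-fixed (echo a)))
      where
      a : Fin (3 + m)
      a = suc (suc t)
      x : Vertex
      x = f (echo a)
      x-pos₀ : x ! pos zero ≡ φ (pos zero) a
      x-pos₀ = lookup-to-pos (echo a) zero
      echoes : Echo x
      echoes = echo-when-pos₀≢0 x (special-preserved _ (echo-special t)) (first-fixed (echo a))
        λ e → contradiction (φ-pos≡0 zero (trans (sym x-pos₀) e)) λ ()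

    φ-pos : ∀ q a → φ (pos q) a ≡ a
    φ-pos q       zero          = φ-pos-zero q
    φ-pos zero    (suc (suc t)) = φ-pos-echo t
    φ-pos (suc q) (suc a)       = φ-pos-gapped (suc a) (λ ()) q
    φ-pos zero    (suc zero)    = injective-fixing-all-but-one _ (φ-injective (pos zero)) (suc zero) others
      where
      others : ∀ b → b ≢ suc zero → φ (pos zero) b ≡ b
      others zero          _   = φ-pos-zero zero
      others (suc zero)    1≢1 = contradiction refl 1≢1
      others (suc (suc t)) _   = φ-pos-echo t

    fixed : ∀ x → f x ≡ x
    fixed x = lookup-ext (f x) x agree
      where
      agree : ∀ i → f x ! i ≡ x ! i
      agree zero          = first-fixed x
      agree (suc zero)    = second-fixed x
      agree (suc (suc q)) = trans (lookup-to-pos x q) (φ-pos q _)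

  colouring-distinguishing : IsDistinguishing (KrPow (3 + m) (4 + n)) (4 + m) colouring
  colouring-distinguishing σ automorphism preserves = ColourPreserving.fixed σ automorphism preserves

mainTheorem6 : (n r : ℕ) → 4 ≤ n → 3 ≤ r → χD≡ (KrPow r n) (r + 1)
mainTheorem6 _ _ (s≤s (s≤s (s≤s (s≤s (z≤n {n}))))) (s≤s (s≤s (s≤s (z≤n {m})))) rewrite ℕₚ.+-comm m 1 =
  (colouring , colouring-proper , colouring-distinguishing) ,
  λ _ (c , proper , distinguishing) → distinguishing-colouring-bound c proper distinguishing
  where open UpperBound n m
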